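{- For every graph $G$ and every set $X\subseteq V(G)$, the following are equivalent: (1) $X$ is a clique transversal of $G$; (2) for every clique $C$ of $G-X$ there exists $x\in X$ with $C\subseteq N_G(x)$; (3) for every clique $C$ of $G-X$ with $|C|\le|X|$ there exists $x\in X$ with $C\subseteq N_G(x)$.
   Context: Graphs are finite, simple and undirected. A clique transversal of $G$ is a set of vertices intersecting every inclusion-maximal clique of $G$. $G-X$ is the subgraph induced by $V(G)\setminus X$; $N_G(x)$ is the set of neighbors of $x$ in $G$. The empty set counts as a clique. -}

module Defs where

open import Data.Nat using (ℕ)
open import Data.Bool using (Bool; true; false)
open import Data.Fin using (Fin)
open import Data.Fin.Subset using (Subset; _∈_; _∉_; _⊆_)
open import Data.Product using (Σ; _×_)
open import Relation.Binary.PropositionalEquality using (_≡_; _≢_)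
open import Relation.Nullary using (¬_)

record Graph (n : ℕ) : Set where
  field
    adj     : Fin n → Fin n → Bool
    sym     : ∀ u v → adj u v ≡ adj v u
    irrefl  : ∀ v → adj v v ≡ false

open Graph public

Adj : ∀ {n} → Graph n → Fin n → Fin n → Set
Adj G u v = adj G u v ≡ true

IsClique : ∀ {n} → Graph n → Subset n → Set
IsClique G C = ∀ u v → u ∈ C → v ∈ C → u ≢ v → Adj G u v

IsMaximalClique : ∀ {n} → Graph n → Subset n → Set
IsMaximalClique G C = IsClique G C × (∀ D → IsClique G D → C ⊆ D → D ⊆ C)

IsCliqueTransversal : ∀ {n} → Graph n → Subset n → Set
IsCliqueTransversal {n} G X =
  ∀ C → IsMaximalClique G C → Σ (Fin n) (λ x → x ∈ X × x ∈ C)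

-- C is a clique of G - X (the subgraph induced on V(G) \ X):
-- a set of vertices outside X that is a clique of G.
IsCliqueMinus : ∀ {n} → Graph n → Subset n → Subset n → Set
IsCliqueMinus G X C = (∀ v → v ∈ C → v ∉ X) × IsClique G C

⊆Nbhd : ∀ {n} → Graph n → Subset n → Fin n → Set
⊆Nbhd G C x = ∀ v → v ∈ C → Adj G x v

{-# OPTIONS --safe #-}
-- (1 ⇒ 2) Extend a clique C of G − X greedily to a maximal clique; a vertex of X in it
-- lies outside C, hence is adjacent to all of C.
-- (3 ⇒ 1) If a maximal clique M misses X, every x ∈ X has a non-neighbour in M (else M ∪ {x}
-- would be a larger clique). Choosing one per x gives a clique C ⊆ M of G − X with |C| ≤ |X|
-- that lies in no N_G(x), contradicting (3).
module Submission where

open import Defs hiding (sym)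
open import Data.Nat using (_≤_; _+_; suc; z≤n; s≤s)
open import Data.Nat.Properties
  using (≤-trans; ≤-reflexive; n≤1+n; +-suc; +-monoʳ-≤; module ≤-Reasoning)
open import Data.Bool using (true)
import Data.Bool.Properties as Bool
open import Data.Fin using (Fin)
import Data.Fin as Fin
open import Data.Fin.Properties using (any?; all?; _≟_)
open import Data.Fin.Subset using (Subset; _∈_; _∉_; _⊆_; _∪_; ⁅_⁆; ⊥; ∣_∣; inside; outside)
open import Data.Fin.Subset.Properties
  using (_∈?_; x∈p∪q⁺; x∈p∪q⁻; p⊆p∪q; q⊆p∪q; x∈⁅x⁆; x∈⁅y⁆⇒x≡y; ∉⊥; ∣⁅x⁆∣≡1; ∣⊥∣≡0; drop-there)
open import Data.List using (List; []; _∷_; foldr; allFin)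
open import Data.List.Membership.Propositional using () renaming (_∈_ to _∈ₗ_)
open import Data.List.Relation.Unary.Any using (here; there)
open import Data.List.Membership.Propositional.Properties using (∈-allFin)
open import Data.Vec.Base using ([]; _∷_) renaming (here to hereᵥ; there to thereᵥ)
open import Data.Product using (Σ; ∃; _×_; _,_; proj₁; proj₂; map; map₁)
open import Data.Sum using (_⊎_; inj₁; inj₂; [_,_]′)
open import Function using (_∘_)
open import Relation.Nullary using (¬_; Dec; yes; no; contradiction)
open import Relation.Nullary.Decidable using (_→-dec_; _×-dec_; ¬?; decidable-stable)
open import Relation.Binary.PropositionalEquality using (refl; sym; trans; subst; cong)

∣p∪q∣≤∣p∣+∣q∣ : ∀ {n} (p q : Subset n) → ∣ p ∪ q ∣ ≤ ∣ p ∣ + ∣ q ∣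
∣p∪q∣≤∣p∣+∣q∣ []            []            = z≤n
∣p∪q∣≤∣p∣+∣q∣ (inside  ∷ p) (inside  ∷ q) =
  s≤s (≤-trans (∣p∪q∣≤∣p∣+∣q∣ p q) (+-monoʳ-≤ ∣ p ∣ (n≤1+n ∣ q ∣)))
∣p∪q∣≤∣p∣+∣q∣ (inside  ∷ p) (outside ∷ q) = s≤s (∣p∪q∣≤∣p∣+∣q∣ p q)
∣p∪q∣≤∣p∣+∣q∣ (outside ∷ p) (inside  ∷ q) =
  ≤-trans (s≤s (∣p∪q∣≤∣p∣+∣q∣ p q)) (≤-reflexive (sym (+-suc ∣ p ∣ ∣ q ∣)))
∣p∪q∣≤∣p∣+∣q∣ (outside ∷ p) (outside ∷ q) = ∣p∪q∣≤∣p∣+∣q∣ p q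

WitnessSet : ∀ {n m} (R : Fin n → Fin m → Set) (X : Subset n) → Subset m → Set
WitnessSet R X C =
  ∣ C ∣ ≤ ∣ X ∣ × (∀ {y} → y ∈ C → ∃ λ x → x ∈ X × R x y) × (∀ {x} → x ∈ X → ∃ λ y → y ∈ C × R x y)

witnessSet : ∀ {n m} (R : Fin n → Fin m → Set) (X : Subset n) →
  (∀ {x} → x ∈ X → ∃ (R x)) → ∃ (WitnessSet R X)
witnessSet {m = m} R [] _ = ⊥ , ≤-reflexive (∣⊥∣≡0 m) , (λ y∈⊥ → contradiction y∈⊥ ∉⊥) , λ ()
witnessSet R (outside ∷ X) witness
  with C , size , sound , complete ← witnessSet (R ∘ Fin.suc) X (witness ∘ thereᵥ)
  = C , size , map Fin.suc (map₁ thereᵥ) ∘ sound , λ { {Fin.suc x} x∈ → complete (drop-there x∈) }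
witnessSet R (inside ∷ X) witness
  with C , size , sound , complete ← witnessSet (R ∘ Fin.suc) X (witness ∘ thereᵥ)
     | y₀ , r₀ ← witness hereᵥ
  = ⁅ y₀ ⁆ ∪ C , size′ , sound′ , complete′
  where
  open ≤-Reasoning
  size′ : ∣ ⁅ y₀ ⁆ ∪ C ∣ ≤ suc ∣ X ∣
  size′ = begin
    ∣ ⁅ y₀ ⁆ ∪ C ∣      ≤⟨ ∣p∪q∣≤∣p∣+∣q∣ ⁅ y₀ ⁆ C ⟩
    ∣ ⁅ y₀ ⁆ ∣ + ∣ C ∣  ≡⟨ cong (_+ ∣ C ∣) (∣⁅x⁆∣≡1 y₀) ⟩
    suc ∣ C ∣           ≤⟨ s≤s size ⟩
    suc ∣ X ∣           ∎
  sound′ : ∀ {y} → y ∈ ⁅ y₀ ⁆ ∪ C → ∃ λ x → x ∈ inside ∷ X × R x y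
  sound′ y∈ with x∈p∪q⁻ ⁅ y₀ ⁆ C y∈
  ... | inj₁ y∈⁅y₀⁆ = Fin.zero , hereᵥ , subst (R Fin.zero) (sym (x∈⁅y⁆⇒x≡y y₀ y∈⁅y₀⁆)) r₀
  ... | inj₂ y∈C    = map Fin.suc (map₁ thereᵥ) (sound y∈C)
  complete′ : ∀ {x} → x ∈ inside ∷ X → ∃ λ y → y ∈ ⁅ y₀ ⁆ ∪ C × R x y
  complete′ {Fin.zero}  _  = y₀ , x∈p∪q⁺ (inj₁ (x∈⁅x⁆ y₀)) , r₀
  complete′ {Fin.suc x} x∈ with y , y∈C , r ← complete (drop-there x∈) = y , x∈p∪q⁺ (inj₂ y∈C) , r

module _ {n} (G : Graph n) where

  Adj? : ∀ u v → Dec (Adj G u v)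
  Adj? u v = adj G u v Bool.≟ true

  Adj-sym : ∀ {u v} → Adj G u v → Adj G v u
  Adj-sym {u} {v} = trans (Graph.sym G v u)

  IsClique? : ∀ C → Dec (IsClique G C)
  IsClique? C = all? λ u → all? λ v →
    (u ∈? C) →-dec ((v ∈? C) →-dec (¬? (u ≟ v) →-dec Adj? u v))

  IsClique-⊆ : ∀ {C D} → C ⊆ D → IsClique G D → IsClique G C
  IsClique-⊆ C⊆D clique u v u∈ v∈ = clique u v (C⊆D u∈) (C⊆D v∈)

  IsClique-∪⁅⁆ : ∀ {C v} → IsClique G C → ⊆Nbhd G C v → IsClique G (C ∪ ⁅ v ⁆)
  IsClique-∪⁅⁆ {C} {v} clique v~C u w u∈ w∈ u≢w
    with x∈p∪q⁻ C ⁅ v ⁆ u∈ | x∈p∪q⁻ C ⁅ v ⁆ w∈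
  ... | inj₁ u∈C | inj₁ w∈C = clique u w u∈C w∈C u≢w
  ... | inj₁ u∈C | inj₂ w∈v rewrite x∈⁅y⁆⇒x≡y v w∈v = Adj-sym (v~C u u∈C)
  ... | inj₂ u∈v | inj₁ w∈C rewrite x∈⁅y⁆⇒x≡y v u∈v = v~C w w∈C
  ... | inj₂ u∈v | inj₂ w∈v = contradiction (trans (x∈⁅y⁆⇒x≡y v u∈v) (sym (x∈⁅y⁆⇒x≡y v w∈v))) u≢w

  grow : Fin n → Subset n → Subset n
  grow v C with IsClique? (C ∪ ⁅ v ⁆)
  ... | yes _ = C ∪ ⁅ v ⁆
  ... | no  _ = C

  ⊆-grow : ∀ v C → C ⊆ grow v C
  ⊆-grow v C with IsClique? (C ∪ ⁅ v ⁆)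
  ... | yes _ = p⊆p∪q ⁅ v ⁆
  ... | no  _ = λ u∈ → u∈

  grow-IsClique : ∀ v {C} → IsClique G C → IsClique G (grow v C)
  grow-IsClique v {C} clique with IsClique? (C ∪ ⁅ v ⁆)
  ... | yes clique′ = clique′
  ... | no  _       = clique

  grow-∈⊎rejected : ∀ v C → v ∈ grow v C ⊎ ¬ IsClique G (C ∪ ⁅ v ⁆)
  grow-∈⊎rejected v C with IsClique? (C ∪ ⁅ v ⁆)
  ... | yes _        = inj₁ (q⊆p∪q C ⁅ v ⁆ (x∈⁅x⁆ v))
  ... | no ¬clique   = inj₂ ¬clique

  growAll : List (Fin n) → Subset n → Subset n
  growAll vs C = foldr grow C vs

  ⊆-growAll : ∀ vs C → C ⊆ growAll vs C
  ⊆-growAll []       C = λ u∈ → u∈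
  ⊆-growAll (v ∷ vs) C = ⊆-grow v (growAll vs C) ∘ ⊆-growAll vs C

  growAll-IsClique : ∀ vs {C} → IsClique G C → IsClique G (growAll vs C)
  growAll-IsClique []       clique = clique
  growAll-IsClique (v ∷ vs) clique = grow-IsClique v (growAll-IsClique vs clique)

  growAll-∈⊎rejected : ∀ {v} vs C → v ∈ₗ vs →
    v ∈ growAll vs C ⊎ ∃ λ D → D ⊆ growAll vs C × ¬ IsClique G (D ∪ ⁅ v ⁆)
  growAll-∈⊎rejected (v ∷ vs) C (here refl) with grow-∈⊎rejected v (growAll vs C)
  ... | inj₁ v∈       = inj₁ v∈
  ... | inj₂ ¬clique  = inj₂ (growAll vs C , ⊆-grow v (growAll vs C) , ¬clique)
  growAll-∈⊎rejected (w ∷ vs) C (there v∈vs) with growAll-∈⊎rejected vs C v∈vs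
  ... | inj₁ v∈                  = inj₁ (⊆-grow w (growAll vs C) v∈)
  ... | inj₂ (D , D⊆ , ¬clique)  = inj₂ (D , ⊆-grow w (growAll vs C) ∘ D⊆ , ¬clique)

  ⊆-maximalClique : ∀ {C} → IsClique G C → ∃ λ M → C ⊆ M × IsMaximalClique G M
  ⊆-maximalClique {C} clique =
    M , ⊆-growAll (allFin n) C , growAll-IsClique (allFin n) clique , maximal
    where
    M : Subset n
    M = growAll (allFin n) C
    maximal : ∀ D → IsClique G D → M ⊆ D → D ⊆ M
    maximal D cliqueD M⊆D {v} v∈D with growAll-∈⊎rejected (allFin n) C (∈-allFin v)
    ... | inj₁ v∈M                  = v∈M
    ... | inj₂ (E , E⊆M , ¬clique) = contradiction (IsClique-⊆ E∪v⊆D cliqueD) ¬clique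
      where
      E∪v⊆D : E ∪ ⁅ v ⁆ ⊆ D
      E∪v⊆D u∈ = [ M⊆D ∘ E⊆M , (λ u∈v → subst (_∈ D) (sym (x∈⁅y⁆⇒x≡y v u∈v)) v∈D) ]′ (x∈p∪q⁻ E ⁅ v ⁆ u∈)

  ∉maximalClique⇒nonNeighbour : ∀ {M v} → IsMaximalClique G M → v ∉ M → ∃ λ u → u ∈ M × ¬ Adj G v u
  ∉maximalClique⇒nonNeighbour {M} {v} (clique , maximal) v∉M
    with any? (λ u → (u ∈? M) ×-dec ¬? (Adj? v u))
  ... | yes nonneighbour = nonneighbour
  ... | no ∄nonneighbour = contradiction (maximal (M ∪ ⁅ v ⁆) clique′ (p⊆p∪q ⁅ v ⁆) v∈M∪v) v∉M
    where
    v~M : ⊆Nbhd G M v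
    v~M u u∈M = decidable-stable (Adj? v u) (λ ¬adj → ∄nonneighbour (u , u∈M , ¬adj))
    clique′ : IsClique G (M ∪ ⁅ v ⁆)
    clique′ = IsClique-∪⁅⁆ clique v~M
    v∈M∪v : v ∈ M ∪ ⁅ v ⁆
    v∈M∪v = q⊆p∪q M ⁅ v ⁆ (x∈⁅x⁆ v)

  ⊆Nbhd-of-member : ∀ {C D x} → IsClique G D → C ⊆ D → x ∈ D → x ∉ C → ⊆Nbhd G C x
  ⊆Nbhd-of-member cliqueD C⊆D x∈D x∉C v v∈C =
    cliqueD _ v x∈D (C⊆D v∈C) λ { refl → x∉C v∈C }

  module _ (X : Subset n) where

    ⊆NbhdOfSome : Subset n → Set
    ⊆NbhdOfSome C = Σ (Fin n) λ x → x ∈ X × ⊆Nbhd G C x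

    transversal⇒⊆NbhdOfSome : IsCliqueTransversal G X → ∀ C → IsCliqueMinus G X C → ⊆NbhdOfSome C
    transversal⇒⊆NbhdOfSome transversal C (C⊆∁X , clique)
      with M , C⊆M , maximalM ← ⊆-maximalClique clique
      with x , x∈X , x∈M ← transversal M maximalM
      = x , x∈X , ⊆Nbhd-of-member (proj₁ maximalM) C⊆M x∈M λ x∈C → C⊆∁X x x∈C x∈X

    small⊆NbhdOfSome⇒transversal :
      (∀ C → IsCliqueMinus G X C → ∣ C ∣ ≤ ∣ X ∣ → ⊆NbhdOfSome C) → IsCliqueTransversal G X
    small⊆NbhdOfSome⇒transversal hyp M maximalM with any? (λ x → (x ∈? X) ×-dec (x ∈? M))
    ... | yes x∈X∩M = x∈X∩M
    ... | no  X∩M-empty = contradict (witnessSet NonNeighbourIn X nonNeighbour)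
      where
      NonNeighbourIn : Fin n → Fin n → Set
      NonNeighbourIn x u = u ∈ M × ¬ Adj G x u
      nonNeighbour : ∀ {x} → x ∈ X → ∃ (NonNeighbourIn x)
      nonNeighbour x∈X = ∉maximalClique⇒nonNeighbour maximalM λ x∈M → X∩M-empty (_ , x∈X , x∈M)
      contradict : ∃ (WitnessSet NonNeighbourIn X) → ∃ λ x → x ∈ X × x ∈ M
      contradict (C , size , sound , complete) =
        contradiction (hyp C (C⊆∁X , IsClique-⊆ C⊆M (proj₁ maximalM)) size) not⊆NbhdOfSome
        where
        C⊆M : C ⊆ M
        C⊆M u∈C = proj₁ (proj₂ (proj₂ (sound u∈C)))
        C⊆∁X : ∀ u → u ∈ C → u ∉ X
        C⊆∁X u u∈C u∈X = X∩M-empty (u , u∈X , C⊆M u∈C)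
        not⊆NbhdOfSome : ¬ ⊆NbhdOfSome C
        not⊆NbhdOfSome (x , x∈X , x~C) with u , u∈C , _ , ¬adj ← complete x∈X = ¬adj (x~C u u∈C)

lemma4p2 : ∀ {n} (G : Graph n) (X : Subset n) →
    (IsCliqueTransversal G X →
      (∀ C → IsCliqueMinus G X C → Σ (Fin n) (λ x → x ∈ X × ⊆Nbhd G C x)))
    × ((∀ C → IsCliqueMinus G X C → Σ (Fin n) (λ x → x ∈ X × ⊆Nbhd G C x)) →
      (∀ C → IsCliqueMinus G X C → ∣ C ∣ ≤ ∣ X ∣ → Σ (Fin n) (λ x → x ∈ X × ⊆Nbhd G C x)))
    × ((∀ C → IsCliqueMinus G X C → ∣ C ∣ ≤ ∣ X ∣ → Σ (Fin n) (λ x → x ∈ X × ⊆Nbhd G C x)) →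
      IsCliqueTransversal G X)
lemma4p2 G X =
  transversal⇒⊆NbhdOfSome G X ,
  (λ seen C clique _ → seen C clique) ,
  small⊆NbhdOfSome⇒transversal G X
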